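{- Let $H$ be a type B or type C Hessenberg space and $i\in[n]$ such that either $i\neq n-1$ and $\{t_{i-1},t_i\}\cap S(H)=\emptyset$, or $i=n-1$ and $\{t_{n-2},t_{n-1},t_n\}\cap S(H)=\emptyset$. Then $\mathbf{f}_i^A\in\mathcal{M}_H$ for every unbalanced $A\subseteq[\bar n]$ with $|A|=i$.
   Context: Let $n\ge 2$, $[n]=\{1,\dots,n\}$, $[\bar n]=\{\pm1,\dots,\pm n\}$, $\bar i=-i$. $\mathfrak{W}_n$ is the group of bijections $w$ of $[\bar n]$ with $w(\bar i)=\overline{w(i)}$. For $p,q\in[\bar n]$, $q\ne\pm p$, $(p,q)$ exchanges $p\leftrightarrow q$, $\bar p\leftrightarrow\bar q$; $(p,\bar p)$ exchanges $p,\bar p$. Roots: type B $\Phi^+=\{e_i\pm e_j:i<j\}\cup\{e_i\}$, $\alpha_i=e_i-e_{i+1}$, $\alpha_n=e_n$; type C $\Phi^+=\{e_i\pm e_j\}\cup\{2e_i\}$, $\alpha_n=2e_n$; $\Delta=\{\alpha_i\}$; $\alpha\le\beta$ iff $\beta-\alpha$ is a nonnegative integer combination of simple roots. A Hessenberg space is a lower order ideal $H\supseteq\Delta$ of $\Phi^+$. Reflections: $e_i-e_j\mapsto(i,j)$, $e_i+e_j\mapsto(i,\bar j)$, $e_i$ or $2e_i\mapsto(i,\bar i)$; $S(H)$ = reflections of roots in $H$. Transpositions: $t_i=(i,i+2)$ ($i\in[n-2]$), $t_{n-1}=(n-1,\overline{n-1})$, $t_n=(n-1,\bar n)$; conditions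 involving $t_0$ are read with $t_0\notin S(H)$. With $x_{\bar k}:=-x_k$, $\mathcal{M}_H$ is the set of $\rho:\mathfrak{W}_n\to\mathbb{C}[x_1,\dots,x_n]$ with $\rho(w)-\rho(ws)\in\langle x_{w(p)}-x_{w(q)}\rangle$ for all $w$ and all $s\in S(H)$ exchanging $p$ and $q$ ($q\ne p$, possibly $q=\bar p$). $A\subseteq[\bar n]$ is unbalanced if $a\in A\Rightarrow\bar a\notin A$; for $|A|=i$, $\mathbf{f}_i^A(w)=x_{w(i)}-x_{w(i+1)}$ if $w([i])=A$ and $i<n$, $\mathbf{f}_n^A(w)=x_{w(n)}$ if $w([n])=A$, and $0$ otherwise. -}

module Defs where

import Data.Bool as Bool
open import Data.Bool using (Bool; true; false; not; _∧_; _∨_; _xor_; if_then_else_; T)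
open import Data.Nat as ℕ using (ℕ; zero; suc; _∸_; _<ᵇ_)
open import Data.Fin as Fin using (Fin; toℕ; fromℕ<)
open import Data.Fin.Properties as FinP using ()
open import Data.Fin.Permutation as Perm using (Permutation′; _⟨$⟩ʳ_; _∘ₚ_; transpose)
open import Data.List as List using (List; []; _∷_; _++_; map; concatMap; filter; length; foldr; allFin)
open import Data.Bool.ListAction using (any; all)
open import Data.Vec as Vec using (Vec; replicate; zipWith; tabulate)
open import Data.Vec.Properties as VecP using ()
open import Data.Integer as ℤ using (ℤ; +_)
open import Data.Rational as ℚ using (ℚ; 0ℚ; 1ℚ)
open import Data.Product using (Σ; ∃; _×_; _,_)
open import Data.Maybe using (Maybe; just; nothing)
open import Data.Empty using (⊥)
open import Data.Unit using (⊤)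
open import Relation.Nullary using (¬_; yes; no; does)
open import Relation.Binary.PropositionalEquality using (_≡_)

-- Indices of the paper are 1..n; an element k : Fin n
-- stands for the paper index toℕ k + 1.  Natural-number indices i of
-- the paper (like i in f_i^A, or k in t_k) are kept as ℕ and converted
-- with finOf (paper index p ↦ Fin index p - 1).

finOf : (n a : ℕ) → Maybe (Fin n)
finOf n a with a ℕ.<? n
... | yes p = just (fromℕ< p)
... | no _  = nothing

_==F_ : ∀ {n} → Fin n → Fin n → Bool
i ==F j = does (i Fin.≟ j)

-- The signed set [n̄] = {±1,…,±n}: (b , k) is  k  if b = false and  k̄ if b = true.

SFin : ℕ → Set
SFin n = Bool × Fin n

pos neg : ∀ {n} → Fin n → SFin n
pos k = false , k
neg k = true , k

bar : ∀ {n} → SFin n → SFin n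
bar (b , k) = not b , k

_==S_ : ∀ {n} → SFin n → SFin n → Bool
(b , k) ==S (c , l) = does (b Bool.≟ c) ∧ (k ==F l)

allS : (n : ℕ) → List (SFin n)
allS n = map pos (allFin n) ++ map neg (allFin n)

-- The hyperoctahedral group 𝔚_n of bijections w of [n̄] with w(ī) = \overline{w(i)}.
-- Such a w is determined by a permutation π of [n] and signs ε:
-- w(k) = ε(k)·π(k), w(k̄) = \overline{w(k)}.

record W (n : ℕ) : Set where
  constructor signedPerm
  field
    perm : Permutation′ n
    sgn  : Fin n → Bool
open W public

act : ∀ {n} → W n → SFin n → SFin n
act w (b , k) = (b xor sgn w k) , (perm w ⟨$⟩ʳ k)

-- product in 𝔚_n:  act (w · s) = act w ∘ act s
_·_ : ∀ {n} → W n → W n → W n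
w · s = signedPerm (perm s ∘ₚ perm w) (λ k → sgn s k xor sgn w (perm s ⟨$⟩ʳ k))

_≈W_ : ∀ {n} → W n → W n → Set
w ≈W v = ∀ a → act w a ≡ act v a

-- transpositions:  (i , j) ,  (i , j̄) ,  (i , ī)
tr trBar : ∀ {n} → Fin n → Fin n → W n
tr i j    = signedPerm (transpose i j) (λ _ → false)
trBar i j = signedPerm (transpose i j) (λ k → (k ==F i) ∨ (k ==F j))

trNeg : ∀ {n} → Fin n → W n
trNeg i = signedPerm Perm.id (λ k → k ==F i)

data Typ : Set where
  B C : Typ

-- minus i j = e_i - e_j, plus i j = e_i + e_j (i < j), short i = e_i (B) or 2e_i (C)
data Root (n : ℕ) : Set where
  minus : (i j : Fin n) → i Fin.< j → Root n
  plus  : (i j : Fin n) → i Fin.< j → Root n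
  short : (i : Fin n) → Root n

Vecℤ : ℕ → Set
Vecℤ n = Fin n → ℤ

e : ∀ {n} → Fin n → Vecℤ n
e i k = if k ==F i then + 1 else + 0

shortVec : ∀ {n} → Typ → Fin n → Vecℤ n
shortVec B i = e i
shortVec C i k = + 2 ℤ.* e i k

vec : ∀ {n} → Typ → Root n → Vecℤ n
vec t (minus i j _) k = e i k ℤ.- e j k
vec t (plus i j _)  k = e i k ℤ.+ e j k
vec t (short i)     k = shortVec t i k

simpleVec : ∀ {n} → Typ → Fin n → Vecℤ n
simpleVec {n} t m with finOf n (suc (toℕ m))
... | just m' = λ k → e m k ℤ.- e m' k
... | nothing = shortVec t m

IsSimple : ∀ {n} → Root n → Set
IsSimple     (minus i j _) = toℕ j ≡ suc (toℕ i)
IsSimple     (plus i j _)  = ⊥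
IsSimple {n} (short i)     = suc (toℕ i) ≡ n

sumFin : ∀ {n} → (Fin n → ℤ) → ℤ
sumFin {zero}  f = + 0
sumFin {suc n} f = f Fin.zero ℤ.+ sumFin (λ k → f (Fin.suc k))

_≤[_]_ : ∀ {n} → Root n → Typ → Root n → Set
_≤[_]_ {n} α t β =
  Σ (Fin n → ℕ) λ c → ∀ k → vec t β k ℤ.- vec t α k ≡ sumFin (λ m → + c m ℤ.* simpleVec t m k)

IsHessenberg : ∀ {n} → Typ → (Root n → Set) → Set
IsHessenberg t H =
  (∀ α β → α ≤[ t ] β → H β → H α) × (∀ r → IsSimple r → H r)

refl : ∀ {n} → Root n → W n
refl (minus i j _) = tr i j
refl (plus i j _)  = trBar i j
refl (short i)     = trNeg i

exch : ∀ {n} → Root n → SFin n × SFin n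
exch (minus i j _) = pos i , pos j
exch (plus i j _)  = pos i , neg j
exch (short i)     = pos i , neg i

InS : ∀ {n} → (Root n → Set) → W n → Set
InS {n} H s = Σ (Root n) λ r → H r × (s ≈W refl r)

-- the transposition t_k (paper index k), built from paper indices:
--   t_k = (k, k+2) for 1 ≤ k ≤ n-2,  t_{n-1} = (n-1, \overline{n-1}),  t_n = (n-1, n̄);
--   nothing for k = 0 (t_0 does not exist, read as t_0 ∉ S(H)) and k > n.
mk2 : ∀ {n} → (Fin n → Fin n → W n) → ℕ → ℕ → Maybe (W n)
mk2 {n} f p q with finOf n (p ∸ 1) | finOf n (q ∸ 1)
... | just a | just b = just (f a b)
... | _      | _      = nothing

mk1 : ∀ {n} → (Fin n → W n) → ℕ → Maybe (W n)
mk1 {n} f p with finOf n (p ∸ 1)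
... | just a  = just (f a)
... | nothing = nothing

tt : (n k : ℕ) → Maybe (W n)
tt n k =
  if does (k ℕ.≟ 0) then nothing
  else if does (k ℕ.≤? n ∸ 2) then mk2 tr k (k ℕ.+ 2)
  else if does (k ℕ.≟ n ∸ 1) then mk1 trNeg (n ∸ 1)
  else if does (k ℕ.≟ n) then mk2 trBar (n ∸ 1) n
  else nothing

ttInS : ∀ {n} → (Root n → Set) → ℕ → Set
ttInS {n} H k with tt n k
... | just s  = InS H s
... | nothing = ⊥

-- Polynomials in ℚ[x_1,…,x_n]: finite lists of terms (coefficient, exponent vector),
-- compared coefficientwise.

Mono : ℕ → Set
Mono n = Vec ℕ n

Poly : ℕ → Set
Poly n = List (ℚ × Mono n)

coeff : ∀ {n} → Poly n → Mono n → ℚ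
coeff []             m = 0ℚ
coeff ((c , m') ∷ p) m = (if does (VecP.≡-dec ℕ._≟_ m' m) then c else 0ℚ) ℚ.+ coeff p m

_≈P_ : ∀ {n} → Poly n → Poly n → Set
p ≈P q = ∀ m → coeff p m ≡ coeff q m

0P : ∀ {n} → Poly n
0P = []

_+P_ : ∀ {n} → Poly n → Poly n → Poly n
p +P q = p ++ q

-P_ : ∀ {n} → Poly n → Poly n
-P p = map (λ { (c , m) → (ℚ.- c) , m }) p

_-P_ : ∀ {n} → Poly n → Poly n → Poly n
p -P q = p +P (-P q)

_*P_ : ∀ {n} → Poly n → Poly n → Poly n
p *P q = concatMap (λ { (c , m) → map (λ { (d , m') → (c ℚ.* d) , zipWith ℕ._+_ m m' }) q }) p

X : ∀ {n} → Fin n → Poly n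
X k = (1ℚ , tabulate (λ l → if l ==F k then 1 else 0)) ∷ []

xS : ∀ {n} → SFin n → Poly n
xS (false , k) = X k
xS (true  , k) = -P (X k)

_∈⟨_⟩ : ∀ {n} → Poly n → Poly n → Set
_∈⟨_⟩ {n} p ℓ = Σ (Poly n) λ g → p ≈P (g *P ℓ)

InM : ∀ {n} → (Root n → Set) → (W n → Poly n) → Set
InM {n} H ρ = ∀ (w : W n) (r : Root n) → H r →
  let (p , q) = exch r in
  (ρ w -P ρ (w · refl r)) ∈⟨ xS (act w p) -P xS (act w q) ⟩

Unbalanced : ∀ {n} → (SFin n → Bool) → Set
Unbalanced {n} A = ∀ (a : SFin n) → A a ≡ true → A (bar a) ≡ false

card : ∀ {n} → (SFin n → Bool) → ℕ
card {n} A = length (filter (λ a → A a Bool.≟ true) (allS n))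

imageIs : ∀ {n} → W n → ℕ → (SFin n → Bool) → Bool
imageIs {n} w i A =
  all (λ a → does (A a Bool.≟ any (λ k → (toℕ k <ᵇ i) ∧ (act w (pos k) ==S a)) (allFin n))) (allS n)

f : ∀ {n} → ℕ → (SFin n → Bool) → W n → Poly n
f {n} i A w with imageIs w i A | finOf n (i ∸ 1) | finOf n i
... | true | just a | just b  = xS (act w (pos a)) -P xS (act w (pos b))
... | true | just a | nothing = xS (act w (pos a))
... | _    | _      | _       = 0P

-- Fix w and a reflection s = s_r with r ∈ H exchanging p and q, and put
-- ℓ = x_{w(p)} − x_{w(q)}.  Since s moves a point only inside {p, q, p̄, q̄},
-- x_{w(x)} − x_{ws(x)} is a rational multiple of ℓ for every x; hence so is
-- F w − F (ws), where f_i^A v = [v([i]) = A] · F v with F v = x_{v(i)} − x_{v(i+1)}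
-- (or x_{v(n)} when i = n).  If s maps [i] into itself, v([i]) = A holds for w
-- and ws alike and we are done.  Otherwise r = e_i − e_{i+1}, or i = n and r is
-- the short root at n: any other root not preserving [i] lies above the root of
-- one of the excluded t_{i−1}, t_i, t_{n−1}, t_n, which would then belong to the
-- lower ideal H.  In these two cases F w is ℓ, respectively ℓ/2.

module Submission where

open import Defs renaming (refl to reflection; tt to tₖ)
open import Data.Nat as ℕ using (ℕ; zero; suc; _∸_; _≤_; _<_; z≤n; s≤s; s≤s⁻¹)
import Data.Nat.Properties as ℕP
open import Data.Bool as Bool using (Bool; true; false; not; _∧_; _xor_; if_then_else_; T)
open import Data.Bool.ListAction using (any; and)
import Data.Bool.Properties as BoolP
open import Data.Fin as Fin using (Fin; toℕ; fromℕ<)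
import Data.Fin.Properties as FinP
open import Data.Fin.Permutation using (_⟨$⟩ʳ_; transpose)
open import Data.List using ([]; _∷_; map; allFin)
import Data.List.Properties as ListP
open import Data.List.Membership.Propositional using (lose)
open import Data.List.Membership.Propositional.Properties using (∈-allFin)
open import Data.List.Relation.Unary.Any using (satisfied)
open import Data.List.Relation.Unary.Any.Properties using (any⁺; any⁻)
open import Function.Bundles using (Equivalence)
open import Data.Vec using (replicate; zipWith)
import Data.Vec.Properties as VecP
open import Data.Integer as ℤ using (ℤ; +_)
import Data.Integer.Properties as ℤP
import Data.Integer.Solver as ℤSolver
open import Data.Rational as ℚ using (ℚ; 0ℚ; 1ℚ; ½)
import Data.Rational.Properties as ℚP
import Data.Rational.Solver as ℚSolver
open import Data.Maybe using (just; nothing)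
open import Data.Product using (Σ; ∃-syntax; _×_; _,_; proj₁; proj₂)
open import Data.Sum using (_⊎_; inj₁; inj₂; map₁; map₂)
open import Data.Empty using (⊥-elim)
open import Relation.Nullary using (¬_; does; yes; no)
open import Relation.Nullary.Decidable using (dec-true; dec-false; toSum)
open import Relation.Binary.PropositionalEquality
open import Relation.Binary.Definitions using (tri<; tri≈; tri>)
open import Function using (_∘_)

private
  variable
    n : ℕ

-- Coefficients and rational multiples

coeff-++ : (p q : Poly n) (m : Mono n) → coeff (p +P q) m ≡ coeff p m ℚ.+ coeff q m
coeff-++ []             q m = sym (ℚP.+-identityˡ _)
coeff-++ ((c , m′) ∷ p) q m =
  trans (cong (c′ ℚ.+_) (coeff-++ p q m)) (sym (ℚP.+-assoc c′ (coeff p m) (coeff q m)))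
  where
  c′ : ℚ
  c′ = if does (VecP.≡-dec ℕ._≟_ m′ m) then c else 0ℚ

coeff-neg : (p : Poly n) (m : Mono n) → coeff (-P p) m ≡ ℚ.- coeff p m
coeff-neg []             m = refl
coeff-neg ((c , m′) ∷ p) m with does (VecP.≡-dec ℕ._≟_ m′ m)
... | true  = trans (cong (ℚ.- c ℚ.+_) (coeff-neg p m)) (sym (ℚP.neg-distrib-+ c (coeff p m)))
... | false = trans (cong (0ℚ ℚ.+_) (coeff-neg p m)) (sym (ℚP.neg-distrib-+ 0ℚ (coeff p m)))

coeff-− : (p q : Poly n) (m : Mono n) → coeff (p -P q) m ≡ coeff p m ℚ.- coeff q m
coeff-− p q m = trans (coeff-++ p (-P q) m) (cong (coeff p m ℚ.+_) (coeff-neg q m))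

coeff-constant-* : (c : ℚ) (p : Poly n) (m : Mono n) →
  coeff (((c , replicate _ 0) ∷ []) *P p) m ≡ c ℚ.* coeff p m
coeff-constant-* c p m = trans (coeff-++ (scaled p) [] m) (trans (ℚP.+-identityʳ _) (go p))
  where
  scaled : Poly _ → Poly _
  scaled = map (λ { (d , m′) → (c ℚ.* d) , zipWith ℕ._+_ (replicate _ 0) m′ })
  go : ∀ p → coeff (scaled p) m ≡ c ℚ.* coeff p m
  go []             = sym (ℚP.*-zeroʳ c)
  go ((d , m′) ∷ p) rewrite VecP.zipWith-identityˡ {f = ℕ._+_} (λ _ → refl) m′
    with does (VecP.≡-dec ℕ._≟_ m′ m)
  ... | true  = trans (cong (c ℚ.* d ℚ.+_) (go p)) (sym (ℚP.*-distribˡ-+ c d (coeff p m)))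
  ... | false = trans (cong₂ ℚ._+_ (sym (ℚP.*-zeroʳ c)) (go p)) (sym (ℚP.*-distribˡ-+ c 0ℚ (coeff p m)))

-- The ℚ-line through ℓ, as opposed to the ideal p ∈⟨ ℓ ⟩.
record _∈ℚ⟨_⟩ (p ℓ : Poly n) : Set where
  constructor _,_
  field
    scalar   : ℚ
    coeff-≡ : ∀ m → coeff p m ≡ scalar ℚ.* coeff ℓ m

∈ℚ⟨⟩⇒∈⟨⟩ : {p ℓ : Poly n} → p ∈ℚ⟨ ℓ ⟩ → p ∈⟨ ℓ ⟩
∈ℚ⟨⟩⇒∈⟨⟩ {ℓ = ℓ} (c , p≡cℓ) = ((c , replicate _ 0) ∷ []) , λ m → trans (p≡cℓ m) (sym (coeff-constant-* c ℓ m))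

∈ℚ⟨⟩-resp : {p q ℓ : Poly n} → (∀ m → coeff p m ≡ coeff q m) → p ∈ℚ⟨ ℓ ⟩ → q ∈ℚ⟨ ℓ ⟩
∈ℚ⟨⟩-resp p≈q (c , p≡cℓ) = c , λ m → trans (sym (p≈q m)) (p≡cℓ m)

∈ℚ⟨⟩-refl : {ℓ : Poly n} → ℓ ∈ℚ⟨ ℓ ⟩
∈ℚ⟨⟩-refl = 1ℚ , λ m → sym (ℚP.*-identityˡ _)

∈ℚ⟨⟩-0P : {ℓ : Poly n} → 0P ∈ℚ⟨ ℓ ⟩
∈ℚ⟨⟩-0P {ℓ = ℓ} = 0ℚ , λ m → sym (ℚP.*-zeroˡ (coeff ℓ m))

∈ℚ⟨⟩-− : {p q ℓ : Poly n} → p ∈ℚ⟨ ℓ ⟩ → q ∈ℚ⟨ ℓ ⟩ → (p -P q) ∈ℚ⟨ ℓ ⟩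
∈ℚ⟨⟩-− {p = p} {q} {ℓ} (c , p≡cℓ) (d , q≡dℓ) = c ℚ.- d , λ m → begin
  coeff (p -P q) m                        ≡⟨ coeff-− p q m ⟩
  coeff p m ℚ.- coeff q m                 ≡⟨ cong₂ ℚ._-_ (p≡cℓ m) (q≡dℓ m) ⟩
  c ℚ.* coeff ℓ m ℚ.- d ℚ.* coeff ℓ m     ≡⟨ solve 3 (λ c d l → c :* l :- d :* l := (c :- d) :* l) refl c d (coeff ℓ m) ⟩
  (c ℚ.- d) ℚ.* coeff ℓ m                 ∎
  where
  open ≡-Reasoning
  open ℚSolver.+-*-Solver

-- When the flags differ the difference is F or −G, and G = F − (F − G).
∈ℚ⟨⟩-gated : {F G ℓ : Poly n} (b c : Bool) → (F -P G) ∈ℚ⟨ ℓ ⟩ → b ≡ c ⊎ F ∈ℚ⟨ ℓ ⟩ →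
  ((if b then F else 0P) -P (if c then G else 0P)) ∈ℚ⟨ ℓ ⟩
∈ℚ⟨⟩-gated true  true  F-G∈ _          = F-G∈
∈ℚ⟨⟩-gated false false _    _          = ∈ℚ⟨⟩-0P
∈ℚ⟨⟩-gated true  false _    (inj₁ ())
∈ℚ⟨⟩-gated false true  _    (inj₁ ())
∈ℚ⟨⟩-gated true  false _    (inj₂ F∈)  = ∈ℚ⟨⟩-− F∈ ∈ℚ⟨⟩-0P
∈ℚ⟨⟩-gated {F = F} {G} {ℓ} false true F-G∈ (inj₂ F∈) = ∈ℚ⟨⟩-− ∈ℚ⟨⟩-0P G∈
  where
  open ℚSolver.+-*-Solver
  F-[F-G]≈G : ∀ m → coeff (F -P (F -P G)) m ≡ coeff G m
  F-[F-G]≈G m = trans (coeff-− F (F -P G) m) (trans (cong (ℚ._-_ (coeff F m)) (coeff-− F G m))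
    (solve 2 (λ a b → a :- (a :- b) := b) refl (coeff F m) (coeff G m)))
  G∈ : G ∈ℚ⟨ ℓ ⟩
  G∈ = ∈ℚ⟨⟩-resp F-[F-G]≈G (∈ℚ⟨⟩-− F∈ F-G∈)

-- Signed permutations and reflections

act-· : (w s : W n) (x : SFin n) → act (w · s) x ≡ act w (act s x)
act-· w s (b , k) = cong (_, _) (sym (BoolP.xor-assoc b (sgn s k) (sgn w (perm s ⟨$⟩ʳ k))))

act-bar : (w : W n) (x : SFin n) → act w (bar x) ≡ bar (act w x)
act-bar w (b , k) = cong (_, _) (sym (BoolP.not-distribˡ-xor b (sgn w k)))

coeff-xS-bar : (x : SFin n) (m : Mono n) → coeff (xS (bar x)) m ≡ ℚ.- coeff (xS x) m
coeff-xS-bar (false , k) m = coeff-neg (X k) m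
coeff-xS-bar (true  , k) m = trans (solve 1 (λ a → a := :- (:- a)) refl (coeff (X k) m))
                                   (cong ℚ.-_ (sym (coeff-neg (X k) m)))
  where open ℚSolver.+-*-Solver

==F-refl : (k : Fin n) → (k ==F k) ≡ true
==F-refl k = dec-true (k Fin.≟ k) refl

==F-≢ : {k j : Fin n} → k ≢ j → (k ==F j) ≡ false
==F-≢ {k = k} {j} = dec-false (k Fin.≟ j)

transpose-matchˡ : (j l : Fin n) → transpose j l ⟨$⟩ʳ j ≡ l
transpose-matchˡ j l rewrite ==F-refl j = refl

transpose-matchʳ : (j l : Fin n) → transpose j l ⟨$⟩ʳ l ≡ j
transpose-matchʳ j l with l Fin.≟ j
... | yes l≡j = l≡j
... | no  _   rewrite ==F-refl l = refl

transpose-fixes : {j l k : Fin n} → k ≢ j → k ≢ l → transpose j l ⟨$⟩ʳ k ≡ k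
transpose-fixes k≢j k≢l rewrite ==F-≢ k≢j | ==F-≢ k≢l = refl

transpose-involutive : (j l k : Fin n) → transpose j l ⟨$⟩ʳ (transpose j l ⟨$⟩ʳ k) ≡ k
transpose-involutive j l k with toSum (k Fin.≟ j)
... | inj₁ refl = trans (cong (transpose k l ⟨$⟩ʳ_) (transpose-matchˡ k l)) (transpose-matchʳ k l)
... | inj₂ k≢j with toSum (k Fin.≟ l)
...   | inj₁ refl = trans (cong (transpose j k ⟨$⟩ʳ_) (transpose-matchʳ j k)) (transpose-matchˡ j k)
...   | inj₂ k≢l  = trans (cong (transpose j l ⟨$⟩ʳ_) (transpose-fixes k≢j k≢l)) (transpose-fixes k≢j k≢l)

trBar-sgnˡ : (j l : Fin n) → sgn (trBar j l) j ≡ true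
trBar-sgnˡ j l rewrite ==F-refl j = refl

trBar-sgnʳ : (j l : Fin n) → sgn (trBar j l) l ≡ true
trBar-sgnʳ j l rewrite ==F-refl l = BoolP.∨-zeroʳ _

trBar-sgn-other : {j l k : Fin n} → k ≢ j → k ≢ l → sgn (trBar j l) k ≡ false
trBar-sgn-other k≢j k≢l rewrite ==F-≢ k≢j | ==F-≢ k≢l = refl

data ReflectionView (s : W n) (p q x : SFin n) : Set where
  fixed : act s x ≡ x → ReflectionView s p q x
  p↦q   : x ≡ p → act s x ≡ q → ReflectionView s p q x
  q↦p   : x ≡ q → act s x ≡ p → ReflectionView s p q x
  p̄↦q̄   : x ≡ bar p → act s x ≡ bar q → ReflectionView s p q x
  q̄↦p̄   : x ≡ bar q → act s x ≡ bar p → ReflectionView s p q x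

reflectionView : (r : Root n) (x : SFin n) →
  ReflectionView (reflection r) (proj₁ (exch r)) (proj₂ (exch r)) x
reflectionView (minus j l _) (b , k) with toSum (k Fin.≟ j)
reflectionView (minus j l _) (false , k) | inj₁ refl = p↦q refl (cong (false ,_) (transpose-matchˡ k l))
reflectionView (minus j l _) (true  , k) | inj₁ refl = p̄↦q̄ refl (cong (true ,_) (transpose-matchˡ k l))
... | inj₂ k≢j with toSum (k Fin.≟ l)
reflectionView (minus j l _) (false , k) | inj₂ _ | inj₁ refl = q↦p refl (cong (false ,_) (transpose-matchʳ j k))
reflectionView (minus j l _) (true  , k) | inj₂ _ | inj₁ refl = q̄↦p̄ refl (cong (true ,_) (transpose-matchʳ j k))
...   | inj₂ k≢l = fixed (cong₂ _,_ (BoolP.xor-identityʳ b) (transpose-fixes k≢j k≢l))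
reflectionView (plus j l _) (b , k) with toSum (k Fin.≟ j)
reflectionView (plus j l _) (false , k) | inj₁ refl =
  p↦q refl (cong₂ _,_ (trBar-sgnˡ k l) (transpose-matchˡ k l))
reflectionView (plus j l _) (true  , k) | inj₁ refl =
  p̄↦q̄ refl (cong₂ _,_ (cong not (trBar-sgnˡ k l)) (transpose-matchˡ k l))
... | inj₂ k≢j with toSum (k Fin.≟ l)
reflectionView (plus j l _) (false , k) | inj₂ _ | inj₁ refl =
  q̄↦p̄ refl (cong₂ _,_ (trBar-sgnʳ j k) (transpose-matchʳ j k))
reflectionView (plus j l _) (true  , k) | inj₂ _ | inj₁ refl =
  q↦p refl (cong₂ _,_ (cong not (trBar-sgnʳ j k)) (transpose-matchʳ j k))
...   | inj₂ k≢l = fixed (cong₂ _,_ (trans (cong (b xor_) (trBar-sgn-other k≢j k≢l)) (BoolP.xor-identityʳ b))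
                                    (transpose-fixes k≢j k≢l))
reflectionView (short j) (b , k) with toSum (k Fin.≟ j)
reflectionView (short j) (false , k) | inj₁ refl = p↦q refl (cong (_, k) (==F-refl k))
reflectionView (short j) (true  , k) | inj₁ refl = q↦p refl (cong (λ c → not c , k) (==F-refl k))
... | inj₂ k≢j = fixed (cong (_, k) (trans (cong (b xor_) (==F-≢ k≢j)) (BoolP.xor-identityʳ b)))

xor-cancelʳ : (b c : Bool) → (b xor c) xor c ≡ b
xor-cancelʳ b c = trans (BoolP.xor-assoc b c c) (trans (cong (b xor_) (BoolP.xor-same c)) (BoolP.xor-identityʳ b))

trBar-sgn-transpose : (j l k : Fin n) → sgn (trBar j l) (transpose j l ⟨$⟩ʳ k) ≡ sgn (trBar j l) k
trBar-sgn-transpose j l k with toSum (k Fin.≟ j)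
... | inj₁ refl = trans (cong (sgn (trBar k l)) (transpose-matchˡ k l)) (trans (trBar-sgnʳ k l) (sym (trBar-sgnˡ k l)))
... | inj₂ k≢j with toSum (k Fin.≟ l)
...   | inj₁ refl = trans (cong (sgn (trBar j k)) (transpose-matchʳ j k)) (trans (trBar-sgnˡ j k) (sym (trBar-sgnʳ j k)))
...   | inj₂ k≢l  = cong (sgn (trBar j l)) (transpose-fixes k≢j k≢l)

reflection-involutive : (r : Root n) (x : SFin n) → act (reflection r) (act (reflection r) x) ≡ x
reflection-involutive (minus j l _) (b , k) = cong₂ _,_ (xor-cancelʳ b false) (transpose-involutive j l k)
reflection-involutive (plus j l _)  (b , k) =
  cong₂ _,_ (trans (cong ((b xor sgn (trBar j l) k) xor_) (trBar-sgn-transpose j l k)) (xor-cancelʳ b _))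
            (transpose-involutive j l k)
reflection-involutive (short j)     (b , k) = cong (_, k) (xor-cancelʳ b (k ==F j))

ℓ : W n → Root n → Poly n
ℓ w r = xS (act w (proj₁ (exch r))) -P xS (act w (proj₂ (exch r)))

xS-reflection-shift : (w : W n) (r : Root n) (x : SFin n) →
  (xS (act w x) -P xS (act (w · reflection r) x)) ∈ℚ⟨ ℓ w r ⟩
xS-reflection-shift w r x rewrite act-· w (reflection r) x = shift (reflectionView r x)
  where
  open ℚSolver.+-*-Solver
  p q : SFin _
  p = proj₁ (exch r)
  q = proj₂ (exch r)
  φ : SFin _ → Mono _ → ℚ
  φ y m = coeff (xS (act w y)) m
  φ-bar : ∀ y m → φ (bar y) m ≡ ℚ.- φ y m
  φ-bar y m = trans (cong (λ z → coeff (xS z) m) (act-bar w y)) (coeff-xS-bar (act w y) m)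
  by : ∀ y z c → (∀ m → φ y m ℚ.- φ z m ≡ c ℚ.* (φ p m ℚ.- φ q m)) →
       (xS (act w y) -P xS (act w z)) ∈ℚ⟨ ℓ w r ⟩
  by y z c eq = c , λ m →
    trans (coeff-− (xS (act w y)) (xS (act w z)) m)
          (trans (eq m) (cong (c ℚ.*_) (sym (coeff-− (xS (act w p)) (xS (act w q)) m))))
  along : ∀ {z} → act (reflection r) x ≡ z → (xS (act w x) -P xS (act w z)) ∈ℚ⟨ ℓ w r ⟩ →
          (xS (act w x) -P xS (act w (act (reflection r) x))) ∈ℚ⟨ ℓ w r ⟩
  along sx≡z = subst (λ z → (xS (act w x) -P xS (act w z)) ∈ℚ⟨ ℓ w r ⟩) (sym sx≡z)
  shift : ReflectionView (reflection r) p q x →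
          (xS (act w x) -P xS (act w (act (reflection r) x))) ∈ℚ⟨ ℓ w r ⟩
  shift (fixed sx≡x) = along sx≡x (by x x 0ℚ λ m →
    solve 2 (λ a d → a :- a := con 0ℚ :* d) refl (φ x m) (φ p m ℚ.- φ q m))
  shift (p↦q refl sp≡q) = along sp≡q (by p q 1ℚ λ m →
    solve 2 (λ a b → a :- b := con 1ℚ :* (a :- b)) refl (φ p m) (φ q m))
  shift (q↦p refl sq≡p) = along sq≡p (by q p (ℚ.- 1ℚ) λ m →
    solve 2 (λ a b → b :- a := :- con 1ℚ :* (a :- b)) refl (φ p m) (φ q m))
  shift (p̄↦q̄ refl sp̄≡q̄) = along sp̄≡q̄ (by (bar p) (bar q) (ℚ.- 1ℚ) λ m →
    trans (cong₂ ℚ._-_ (φ-bar p m) (φ-bar q m))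
          (solve 2 (λ a b → :- a :- :- b := :- con 1ℚ :* (a :- b)) refl (φ p m) (φ q m)))
  shift (q̄↦p̄ refl sq̄≡p̄) = along sq̄≡p̄ (by (bar q) (bar p) 1ℚ λ m →
    trans (cong₂ ℚ._-_ (φ-bar q m) (φ-bar p m))
          (solve 2 (λ a b → :- b :- :- a := con 1ℚ :* (a :- b)) refl (φ p m) (φ q m)))

-- The image of [i]

T-ext : {a b : Bool} → (T a → T b) → (T b → T a) → a ≡ b
T-ext {false} {false} _ _ = refl
T-ext {false} {true}  _ g = ⊥-elim (g _)
T-ext {true}  {false} f _ = ⊥-elim (f _)
T-ext {true}  {true}  _ _ = refl

==S-sound : (x y : SFin n) → T (x ==S y) → x ≡ y
==S-sound (b , k) (c , l) t with b Bool.≟ c | k Fin.≟ l | t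
... | yes refl | yes refl | _ = refl

==S-refl : (x : SFin n) → T (x ==S x)
==S-refl (b , k) rewrite dec-true (b Bool.≟ b) refl | ==F-refl k = _

-- a ∈ w([i]), in the form tested inside imageIs
inImage : W n → ℕ → SFin n → Bool
inImage {n} w i a = any (λ k → (toℕ k ℕ.<ᵇ i) ∧ (act w (pos k) ==S a)) (allFin n)

inImage-intro : (w : W n) {i : ℕ} (k : Fin n) → toℕ k < i → T (inImage w i (act w (pos k)))
inImage-intro w k k<i =
  any⁺ _ (lose (∈-allFin k) (Equivalence.from BoolP.T-∧ (ℕP.<⇒<ᵇ k<i , ==S-refl (act w (pos k)))))

inImage-elim : {w : W n} {i : ℕ} {a : SFin n} → T (inImage w i a) → ∃[ k ] toℕ k < i × act w (pos k) ≡ a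
inImage-elim {n} {w} {i} {a} h with satisfied (any⁻ _ (allFin n) h)
... | k , t with Equivalence.to BoolP.T-∧ t
... | k<ᵇi , wk==a = k , ℕP.<ᵇ⇒< _ _ k<ᵇi , ==S-sound _ _ wk==a

PreservesPrefix : ℕ → W n → Set
PreservesPrefix {n} i s = ∀ k → toℕ k < i → ∃[ k′ ] act s (pos k) ≡ pos k′ × toℕ k′ < i

inImage-reflection : (w : W n) (r : Root n) {i : ℕ} {a : SFin n} → PreservesPrefix i (reflection r) →
  inImage (w · reflection r) i a ≡ inImage w i a
inImage-reflection w r {i} preserves = T-ext to from
  where
  s : W _
  s = reflection r
  to : ∀ {a} → T (inImage (w · s) i a) → T (inImage w i a)
  to {a} h with inImage-elim {w = w · s} {i} {a} h
  ... | k , k<i , refl with preserves k k<i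
  ... | k′ , sk≡k′ , k′<i = subst (T ∘ inImage w i) (sym (trans (act-· w s (pos k)) (cong (act w) sk≡k′)))
                                  (inImage-intro w k′ k′<i)
  from : ∀ {a} → T (inImage w i a) → T (inImage (w · s) i a)
  from {a} h with inImage-elim {w = w} {i} {a} h
  ... | k , k<i , refl with preserves k k<i
  ... | k′ , sk≡k′ , k′<i = subst (T ∘ inImage (w · s) i)
    (trans (act-· w s (pos k′)) (cong (act w) (trans (cong (act s) (sym sk≡k′)) (reflection-involutive r (pos k)))))
    (inImage-intro (w · s) k′ k′<i)

imageIs-reflection : (w : W n) (r : Root n) (i : ℕ) (A : SFin n → Bool) → PreservesPrefix i (reflection r) →
  imageIs (w · reflection r) i A ≡ imageIs w i A
imageIs-reflection {n} w r i A preserves =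
  cong and (ListP.map-cong (λ a → cong (λ h → does (A a Bool.≟ h)) (inImage-reflection w r preserves)) (allS n))

f-below-n : (i : ℕ) (A : SFin n → Bool) (v : W n) {a b : Fin n} →
  finOf n (i ∸ 1) ≡ just a → finOf n i ≡ just b →
  f i A v ≡ (if imageIs v i A then xS (act v (pos a)) -P xS (act v (pos b)) else 0P)
f-below-n i A v ea eb rewrite ea | eb with imageIs v i A
... | true  = refl
... | false = refl

f-at-n : (i : ℕ) (A : SFin n → Bool) (v : W n) {a : Fin n} →
  finOf n (i ∸ 1) ≡ just a → finOf n i ≡ nothing →
  f i A v ≡ (if imageIs v i A then xS (act v (pos a)) else 0P)
f-at-n i A v ea en rewrite ea | en with imageIs v i A
... | true  = refl
... | false = refl

f-difference-∈⟨ℓ⟩ : (i : ℕ) (A : SFin n → Bool) (F : W n → Poly n) →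
  (∀ v → f i A v ≡ (if imageIs v i A then F v else 0P)) →
  (w : W n) (r : Root n) → (F w -P F (w · reflection r)) ∈ℚ⟨ ℓ w r ⟩ →
  PreservesPrefix i (reflection r) ⊎ F w ∈ℚ⟨ ℓ w r ⟩ →
  (f i A w -P f i A (w · reflection r)) ∈⟨ ℓ w r ⟩
f-difference-∈⟨ℓ⟩ i A F f≡ w r ΔF∈ preserves⊎F∈ rewrite f≡ w | f≡ (w · reflection r) =
  ∈ℚ⟨⟩⇒∈⟨⟩ (∈ℚ⟨⟩-gated (imageIs w i A) (imageIs (w · reflection r) i A) ΔF∈ sameImage⊎F∈)
  where
  sameImage⊎F∈ : imageIs w i A ≡ imageIs (w · reflection r) i A ⊎ F w ∈ℚ⟨ ℓ w r ⟩
  sameImage⊎F∈ = map₁ (sym ∘ imageIs-reflection w r i A) preserves⊎F∈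

xS-difference-reflection-shift : (w : W n) (r : Root n) (x y : SFin n) →
  ((xS (act w x) -P xS (act w y)) -P (xS (act (w · reflection r) x) -P xS (act (w · reflection r) y)))
    ∈ℚ⟨ ℓ w r ⟩
xS-difference-reflection-shift w r x y =
  ∈ℚ⟨⟩-resp regroup (∈ℚ⟨⟩-− (xS-reflection-shift w r x) (xS-reflection-shift w r y))
  where
  open ≡-Reasoning
  open ℚSolver.+-*-Solver
  a b a′ b′ : Poly _
  a = xS (act w x)
  b = xS (act w y)
  a′ = xS (act (w · reflection r) x)
  b′ = xS (act (w · reflection r) y)
  regroup : ∀ m → coeff ((a -P a′) -P (b -P b′)) m ≡ coeff ((a -P b) -P (a′ -P b′)) m
  regroup m = begin
    coeff ((a -P a′) -P (b -P b′)) m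
      ≡⟨ trans (coeff-− (a -P a′) (b -P b′) m) (cong₂ ℚ._-_ (coeff-− a a′ m) (coeff-− b b′ m)) ⟩
    (coeff a m ℚ.- coeff a′ m) ℚ.- (coeff b m ℚ.- coeff b′ m)
      ≡⟨ solve 4 (λ a a′ b b′ → (a :- a′) :- (b :- b′) := (a :- b) :- (a′ :- b′)) refl
               (coeff a m) (coeff a′ m) (coeff b m) (coeff b′ m) ⟩
    (coeff a m ℚ.- coeff b m) ℚ.- (coeff a′ m ℚ.- coeff b′ m)
      ≡⟨ sym (trans (coeff-− (a -P b) (a′ -P b′) m) (cong₂ ℚ._-_ (coeff-− a b m) (coeff-− a′ b′ m))) ⟩
    coeff ((a -P b) -P (a′ -P b′)) m ∎

ℓ-positive-pair : (w : W n) (r : Root n) {a b : Fin n} → exch r ≡ (pos a , pos b) →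
  (xS (act w (pos a)) -P xS (act w (pos b))) ∈ℚ⟨ ℓ w r ⟩
ℓ-positive-pair w r eq rewrite eq = ∈ℚ⟨⟩-refl

-- Here ℓ = x_{w(a)} − x_{w(ā)} = 2 x_{w(a)}.
ℓ-signed-pair : (w : W n) (r : Root n) {a : Fin n} → exch r ≡ (pos a , neg a) →
  xS (act w (pos a)) ∈ℚ⟨ ℓ w r ⟩
ℓ-signed-pair w r {a} eq rewrite eq = ½ , λ m → let x = coeff (xS (act w (pos a))) m in sym (begin
  ½ ℚ.* coeff (xS (act w (pos a)) -P xS (act w (neg a))) m
    ≡⟨ cong (½ ℚ.*_) (coeff-− (xS (act w (pos a))) (xS (act w (neg a))) m) ⟩
  ½ ℚ.* (x ℚ.- coeff (xS (act w (bar (pos a)))) m)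
    ≡⟨ cong (λ y → ½ ℚ.* (x ℚ.- coeff (xS y) m)) (act-bar w (pos a)) ⟩
  ½ ℚ.* (x ℚ.- coeff (xS (bar (act w (pos a)))) m)
    ≡⟨ cong (λ y → ½ ℚ.* (x ℚ.- y)) (coeff-xS-bar (act w (pos a)) m) ⟩
  ½ ℚ.* (x ℚ.- ℚ.- x)
    ≡⟨ solve 1 (λ x → con ½ :* (x :- :- x) := x) refl x ⟩
  x ∎)
  where
  open ≡-Reasoning
  open ℚSolver.+-*-Solver

-- The root order

finOf-just : (n a : ℕ) (x : Fin n) → toℕ x ≡ a → finOf n a ≡ just x
finOf-just n a x x≡a with a ℕ.<? n
... | yes a<n = cong just (FinP.toℕ-injective (trans (FinP.toℕ-fromℕ< a<n) (sym x≡a)))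
... | no  a≮n = ⊥-elim (a≮n (subst (_< n) x≡a (FinP.toℕ<n x)))

finOf-nothing : (n a : ℕ) → n ≤ a → finOf n a ≡ nothing
finOf-nothing n a n≤a with a ℕ.<? n
... | yes a<n = ⊥-elim (ℕP.<⇒≱ a<n n≤a)
... | no  _   = refl

open ℤSolver.+-*-Solver using (solve; _:=_; _:+_; _:-_; _:*_; con)

sumFin-cong : {g h : Fin n → ℤ} → (∀ m → g m ≡ h m) → sumFin g ≡ sumFin h
sumFin-cong {zero}  g≡h = refl
sumFin-cong {suc n} g≡h = cong₂ ℤ._+_ (g≡h Fin.zero) (sumFin-cong (g≡h ∘ Fin.suc))

sumFin-+ : (g h : Fin n → ℤ) → sumFin (λ m → g m ℤ.+ h m) ≡ sumFin g ℤ.+ sumFin h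
sumFin-+ {zero}  g h = refl
sumFin-+ {suc n} g h rewrite sumFin-+ (g ∘ Fin.suc) (h ∘ Fin.suc) =
  solve 4 (λ a b c d → (a :+ b) :+ (c :+ d) := (a :+ c) :+ (b :+ d)) refl
    (g Fin.zero) (h Fin.zero) (sumFin (g ∘ Fin.suc)) (sumFin (h ∘ Fin.suc))

sumFin-zero : (g : Fin n → ℤ) → (∀ m → g m ≡ + 0) → sumFin g ≡ + 0
sumFin-zero {zero}  g g≡0 = refl
sumFin-zero {suc n} g g≡0 rewrite g≡0 Fin.zero | sumFin-zero (g ∘ Fin.suc) (g≡0 ∘ Fin.suc) = refl

indicator : Fin n → Fin n → ℕ
indicator m₀ m = if m ==F m₀ then 1 else 0

sumFin-indicator : (m₀ : Fin n) (h : Fin n → ℤ) → sumFin (λ m → + indicator m₀ m ℤ.* h m) ≡ h m₀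
sumFin-indicator {suc n} Fin.zero h =
  trans (cong₂ ℤ._+_ (ℤP.*-identityˡ (h Fin.zero)) (sumFin-zero _ (λ m → ℤP.*-zeroˡ (h (Fin.suc m)))))
        (ℤP.+-identityʳ _)
sumFin-indicator {suc n} (Fin.suc m₀) h =
  trans (cong₂ ℤ._+_ (ℤP.*-zeroˡ (h Fin.zero)) (sumFin-indicator m₀ (h ∘ Fin.suc))) (ℤP.+-identityˡ _)

-- `α ≤[ t ] β` unfolds to `RootCone t (vec t β − vec t α)`.
RootCone : Typ → (Fin n → ℤ) → Set
RootCone {n} t v = Σ (Fin n → ℕ) λ c → ∀ k → v k ≡ sumFin (λ m → + c m ℤ.* simpleVec t m k)

RootCone-resp : {t : Typ} {u v : Fin n → ℤ} → (∀ k → u k ≡ v k) → RootCone t u → RootCone t v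
RootCone-resp u≡v (c , u≡) = c , λ k → trans (sym (u≡v k)) (u≡ k)

RootCone-zero : {t : Typ} → RootCone {n} t (λ _ → + 0)
RootCone-zero {t = t} = (λ _ → 0) , λ k → sym (sumFin-zero _ (λ m → ℤP.*-zeroˡ (simpleVec t m k)))

RootCone-+ : {t : Typ} {u v : Fin n → ℤ} → RootCone t u → RootCone t v → RootCone t (λ k → u k ℤ.+ v k)
RootCone-+ {t = t} (c , u≡) (d , v≡) = (λ m → c m ℕ.+ d m) , λ k →
  trans (cong₂ ℤ._+_ (u≡ k) (v≡ k))
    (trans (sym (sumFin-+ (λ m → + c m ℤ.* simpleVec t m k) (λ m → + d m ℤ.* simpleVec t m k)))
           (sumFin-cong (λ m → sym (ℤP.*-distribʳ-+ (simpleVec t m k) (+ c m) (+ d m)))))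

RootCone-simple : (t : Typ) (m₀ : Fin n) → RootCone t (simpleVec t m₀)
RootCone-simple t m₀ = indicator m₀ , λ k → sym (sumFin-indicator m₀ (λ m → simpleVec t m k))

simpleVec-step : (t : Typ) {m m′ : Fin n} → finOf n (suc (toℕ m)) ≡ just m′ →
  ∀ k → simpleVec t m k ≡ e m k ℤ.- e m′ k
simpleVec-step {n} t {m} eq k with finOf n (suc (toℕ m))
simpleVec-step t refl k | just _ = refl

simpleVec-last : (t : Typ) {m : Fin n} → finOf n (suc (toℕ m)) ≡ nothing →
  ∀ k → simpleVec t m k ≡ shortVec t m k
simpleVec-last {n} t {m} eq k with finOf n (suc (toℕ m))
simpleVec-last t refl k | nothing = refl

-- e_u − e_v = α_u + ⋯ + α_{v−1}
RootCone-e−e : (t : Typ) (u v : Fin n) → toℕ u ≤ toℕ v → RootCone t (λ k → e u k ℤ.- e v k)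
RootCone-e−e {n} t u v u≤v = go (toℕ v ∸ toℕ u) v (sym (ℕP.m∸n+n≡m u≤v))
  where
  go : ∀ d v → toℕ v ≡ d ℕ.+ toℕ u → RootCone t (λ k → e u k ℤ.- e v k)
  go zero v v≡u with FinP.toℕ-injective v≡u
  ... | refl = RootCone-resp (λ k → sym (ℤP.+-inverseʳ (e u k))) RootCone-zero
  go (suc d) v v≡ = RootCone-resp telescope (RootCone-+ (go d v′ (FinP.toℕ-fromℕ< v′<n)) (RootCone-simple t v′))
    where
    v′<n : d ℕ.+ toℕ u < n
    v′<n = ℕP.<-trans (ℕP.n<1+n _) (subst (_< n) v≡ (FinP.toℕ<n v))
    v′ : Fin n
    v′ = fromℕ< v′<n
    v-next : finOf n (suc (toℕ v′)) ≡ just v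
    v-next = finOf-just n _ v (trans v≡ (cong suc (sym (FinP.toℕ-fromℕ< v′<n))))
    telescope : ∀ k → (e u k ℤ.- e v′ k) ℤ.+ simpleVec t v′ k ≡ e u k ℤ.- e v k
    telescope k rewrite simpleVec-step t v-next k =
      solve 3 (λ a b c → (a :- b) :+ (b :- c) := a :- c) refl (e u k) (e v′ k) (e v k)

RootCone-shortVec-last : (t : Typ) → RootCone t (shortVec t (Fin.fromℕ n))
RootCone-shortVec-last {n} t = RootCone-resp (simpleVec-last t (finOf-nothing (suc n) _ n<1+n)) (RootCone-simple t _)
  where
  n<1+n : suc n ≤ suc (toℕ (Fin.fromℕ n))
  n<1+n = ℕP.≤-reflexive (cong suc (sym (FinP.toℕ-fromℕ n)))

RootCone-2e-last : (t : Typ) → RootCone t (λ k → e (Fin.fromℕ n) k ℤ.+ e (Fin.fromℕ n) k)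
RootCone-2e-last B = RootCone-+ (RootCone-shortVec-last B) (RootCone-shortVec-last B)
RootCone-2e-last {n} C = RootCone-resp (λ k → solve 1 (λ x → con (+ 2) :* x := x :+ x) refl (e (Fin.fromℕ n) k))
                                       (RootCone-shortVec-last C)

RootCone-e+e : (t : Typ) (u v : Fin (suc n)) → RootCone t (λ k → e u k ℤ.+ e v k)
RootCone-e+e {n} t u v =
  RootCone-resp (λ k → solve 3 (λ a b c → ((a :- c) :+ (b :- c)) :+ (c :+ c) := a :+ b) refl (e u k) (e v k) (e z k))
    (RootCone-+ (RootCone-+ (RootCone-e−e t u z (FinP.≤fromℕ u)) (RootCone-e−e t v z (FinP.≤fromℕ v))) (RootCone-2e-last t))
  where
  z : Fin (suc n)
  z = Fin.fromℕ n

RootCone-e-B : (u : Fin (suc n)) → RootCone B (e u)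
RootCone-e-B {n} u = RootCone-resp (λ k → solve 2 (λ a c → (a :- c) :+ c := a) refl (e u k) (e (Fin.fromℕ n) k))
  (RootCone-+ (RootCone-e−e B u (Fin.fromℕ n) (FinP.≤fromℕ u)) (RootCone-shortVec-last B))

minus≤minus : (t : Typ) {j l x y : Fin n} (x<y : x Fin.< y) (j<l : j Fin.< l) →
  toℕ j ≤ toℕ x → toℕ y ≤ toℕ l → minus x y x<y ≤[ t ] minus j l j<l
minus≤minus t {j} {l} {x} {y} _ _ j≤x y≤l =
  RootCone-resp (λ k → solve 4 (λ j l x y → (j :- x) :+ (y :- l) := (j :- l) :- (x :- y)) refl
                               (e j k) (e l k) (e x k) (e y k))
    (RootCone-+ (RootCone-e−e t j x j≤x) (RootCone-e−e t y l y≤l))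

minus≤plus : (t : Typ) {j l x y : Fin (suc n)} (x<y : x Fin.< y) (j<l : j Fin.< l) →
  toℕ j ≤ toℕ x → minus x y x<y ≤[ t ] plus j l j<l
minus≤plus t {j} {l} {x} {y} _ _ j≤x =
  RootCone-resp (λ k → solve 4 (λ j l x y → (j :- x) :+ (l :+ y) := (j :+ l) :- (x :- y)) refl
                               (e j k) (e l k) (e x k) (e y k))
    (RootCone-+ (RootCone-e−e t j x j≤x) (RootCone-e+e t l y))

plus≤plus : (t : Typ) {j l x y : Fin n} (x<y : x Fin.< y) (j<l : j Fin.< l) →
  toℕ j ≤ toℕ x → toℕ l ≤ toℕ y → plus x y x<y ≤[ t ] plus j l j<l
plus≤plus t {j} {l} {x} {y} _ _ j≤x l≤y =
  RootCone-resp (λ k → solve 4 (λ j l x y → (j :- x) :+ (l :- y) := (j :+ l) :- (x :+ y)) refl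
                               (e j k) (e l k) (e x k) (e y k))
    (RootCone-+ (RootCone-e−e t j x j≤x) (RootCone-e−e t l y l≤y))

minus≤short : (t : Typ) {j x y : Fin (suc n)} (x<y : x Fin.< y) → toℕ j ≤ toℕ x → minus x y x<y ≤[ t ] short j
minus≤short B {j} {x} {y} _ j≤x =
  RootCone-resp (λ k → solve 3 (λ j x y → (j :- x) :+ y := j :- (x :- y)) refl (e j k) (e x k) (e y k))
    (RootCone-+ (RootCone-e−e B j x j≤x) (RootCone-e-B y))
minus≤short C {j} {x} {y} _ j≤x =
  RootCone-resp (λ k → solve 3 (λ j x y → (j :- x) :+ (j :+ y) := con (+ 2) :* j :- (x :- y)) refl
                               (e j k) (e x k) (e y k))
    (RootCone-+ (RootCone-e−e C j x j≤x) (RootCone-e+e C j y))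

short≤short : (t : Typ) {j x : Fin n} → toℕ j ≤ toℕ x → short x ≤[ t ] short j
short≤short B {j} {x} j≤x = RootCone-e−e B j x j≤x
short≤short C {j} {x} j≤x =
  RootCone-resp (λ k → solve 2 (λ j x → (j :- x) :+ (j :- x) := con (+ 2) :* j :- con (+ 2) :* x) refl (e j k) (e x k))
    (RootCone-+ (RootCone-e−e C j x j≤x) (RootCone-e−e C j x j≤x))

-- The transpositions t_k and the roots of H

ttInS-intro : (H : Root n → Set) (k : ℕ) {s : W n} → tₖ n k ≡ just s → InS H s → ttInS H k
ttInS-intro {n} H k eq s∈S with tₖ n k
ttInS-intro H k refl s∈S | just _ = s∈S

module Transpositions (m : ℕ) where

  N : ℕ
  N = suc (suc m)

  tₖ≡tr : (k : ℕ) → 1 ≤ k → k ≤ m → (x y : Fin N) → toℕ x ≡ k ∸ 1 → toℕ y ≡ suc k →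
    tₖ N k ≡ just (tr x y)
  tₖ≡tr (suc k) _ k≤m x y x≡ y≡
    rewrite dec-true (suc k ℕ.≤? m) k≤m
          | finOf-just N k x x≡
          | finOf-just N (suc k ℕ.+ 2 ∸ 1) y (trans y≡ (cong (_∸ 1) (ℕP.+-comm 2 (suc k)))) = refl

  tₙ₋₁≡trNeg : (x : Fin N) → toℕ x ≡ m → tₖ N (suc m) ≡ just (trNeg x)
  tₙ₋₁≡trNeg x x≡
    rewrite dec-false (suc m ℕ.≤? m) (ℕP.n≮n m)
          | dec-true (suc m ℕ.≟ suc m) refl
          | finOf-just N m x x≡ = refl

  tₙ≡trBar : (x y : Fin N) → toℕ x ≡ m → toℕ y ≡ suc m → tₖ N N ≡ just (trBar x y)
  tₙ≡trBar x y x≡ y≡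
    rewrite dec-false (N ℕ.≤? m) (ℕP.<⇒≱ (ℕP.m<n+m m (s≤s z≤n)))
          | dec-false (N ℕ.≟ suc m) ℕP.1+n≢n
          | dec-true (N ℕ.≟ N) refl
          | finOf-just N m x x≡
          | finOf-just N (suc m) y y≡ = refl

  -- The hypothesis on t_{i−1}, t_i, t_{n−1}, t_n, for the paper index i = suc i′.
  record Excluded (H : Root N → Set) (i′ : ℕ) : Set where
    field
      tᵢ₋₁∉S : ¬ ttInS H i′
      tᵢ∉S   : suc i′ ≤ m → ¬ ttInS H (suc i′)
      tₙ₋₁∉S : m ≤ i′ → ¬ ttInS H (suc m)
      tₙ∉S   : m ≤ i′ → ¬ ttInS H N

  excluded : (H : Root N → Set) (i′ : ℕ) → i′ ≤ suc m →
    ((suc i′ ≢ suc m) × ¬ ttInS H i′ × ¬ ttInS H (suc i′))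
      ⊎ ((suc i′ ≡ suc m) × ¬ ttInS H m × ¬ ttInS H (suc m) × ¬ ttInS H N) →
    Excluded H i′
  excluded H i′ i′≤ (inj₁ (i≢n-1 , tᵢ₋₁∉S , tᵢ∉S)) = record
    { tᵢ₋₁∉S = tᵢ₋₁∉S
    ; tᵢ∉S   = λ _ → tᵢ∉S
    ; tₙ₋₁∉S = λ m≤i′ → subst (¬_ ∘ ttInS H) (i′≡n-1 m≤i′) tᵢ₋₁∉S
    ; tₙ∉S   = λ m≤i′ → subst (¬_ ∘ ttInS H ∘ suc) (i′≡n-1 m≤i′) tᵢ∉S
    }
    where
    i′≡n-1 : m ≤ i′ → i′ ≡ suc m
    i′≡n-1 m≤i′ with ℕP.m≤n⇒m<n∨m≡n m≤i′
    ... | inj₁ m<i′ = ℕP.≤-antisym i′≤ m<i′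
    ... | inj₂ m≡i′ = ⊥-elim (i≢n-1 (cong suc (sym m≡i′)))
  excluded H i′ i′≤ (inj₂ (refl , tₙ₋₂∉S , tₙ₋₁∉S , tₙ∉S)) = record
    { tᵢ₋₁∉S = tₙ₋₂∉S
    ; tᵢ∉S   = λ i≤n-2 → ⊥-elim (ℕP.n≮n i′ i≤n-2)
    ; tₙ₋₁∉S = λ _ → tₙ₋₁∉S
    ; tₙ∉S   = λ _ → tₙ∉S
    }

-- The paper index i is suc i′, and a is its Fin index.
module Classification {m : ℕ} (t : Typ) (H : Root (suc (suc m)) → Set)
         (lower : ∀ α β → α ≤[ t ] β → H β → H α)
         {i′ : ℕ} (i′≤ : i′ ≤ suc m) (excl : Transpositions.Excluded m H i′)
         (a : Fin (suc (suc m))) (a≡i′ : toℕ a ≡ i′) where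

  open Transpositions m
  open Excluded excl

  Classified : Root N → Set
  Classified r = PreservesPrefix (suc i′) (reflection r)
    ⊎ (∃[ b ] toℕ b ≡ suc i′ × exch r ≡ (pos a , pos b))
    ⊎ (i′ ≡ suc m × exch r ≡ (pos a , neg a))

  tₖ-middle∈S : (k : ℕ) → 1 ≤ k → k ≤ m → {r : Root N} → H r →
    ((x y : Fin N) (x<y : x Fin.< y) → toℕ x ≡ k ∸ 1 → toℕ y ≡ suc k → minus x y x<y ≤[ t ] r) →
    ttInS H k
  tₖ-middle∈S k 1≤k k≤m Hr below =
    ttInS-intro H k (tₖ≡tr k 1≤k k≤m x y x≡ y≡) (minus x y x<y , lower _ _ (below x y x<y x≡ y≡) Hr , λ _ → refl)
    where
    y<N : suc k < N
    y<N = s≤s (s≤s k≤m)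
    x<N : k ∸ 1 < N
    x<N = ℕP.≤-<-trans (ℕP.m∸n≤m k 1) (ℕP.<-trans (ℕP.n<1+n k) y<N)
    x y : Fin N
    x = fromℕ< x<N
    y = fromℕ< y<N
    x≡ : toℕ x ≡ k ∸ 1
    x≡ = FinP.toℕ-fromℕ< x<N
    y≡ : toℕ y ≡ suc k
    y≡ = FinP.toℕ-fromℕ< y<N
    x<y : x Fin.< y
    x<y = subst₂ _<_ (sym x≡) (sym y≡) (ℕP.≤-<-trans (ℕP.m∸n≤m k 1) (ℕP.n<1+n k))

  tₙ₋₁∈S : {r : Root N} → H r → ((x : Fin N) → toℕ x ≡ m → short x ≤[ t ] r) → ttInS H (suc m)
  tₙ₋₁∈S Hr below = ttInS-intro H (suc m) (tₙ₋₁≡trNeg x x≡) (short x , lower _ _ (below x x≡) Hr , λ _ → refl)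
    where
    x<N : m < N
    x<N = ℕP.<-trans (ℕP.n<1+n m) (ℕP.n<1+n (suc m))
    x : Fin N
    x = fromℕ< x<N
    x≡ : toℕ x ≡ m
    x≡ = FinP.toℕ-fromℕ< x<N

  tₙ∈S : {r : Root N} → H r →
    ((x y : Fin N) (x<y : x Fin.< y) → toℕ x ≡ m → toℕ y ≡ suc m → plus x y x<y ≤[ t ] r) → ttInS H N
  tₙ∈S Hr below =
    ttInS-intro H N (tₙ≡trBar x y x≡ y≡) (plus x y x<y , lower _ _ (below x y x<y x≡ y≡) Hr , λ _ → refl)
    where
    x<N : m < N
    x<N = ℕP.<-trans (ℕP.n<1+n m) (ℕP.n<1+n (suc m))
    x y : Fin N
    x = fromℕ< x<N
    y = Fin.fromℕ (suc m)
    x≡ : toℕ x ≡ m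
    x≡ = FinP.toℕ-fromℕ< x<N
    y≡ : toℕ y ≡ suc m
    y≡ = FinP.toℕ-fromℕ (suc m)
    x<y : x Fin.< y
    x<y = subst₂ _<_ (sym x≡) (sym y≡) (ℕP.n<1+n m)

  fixes-prefix : (s : W N) → (∀ {k} → toℕ k < suc i′ → act s (pos k) ≡ pos k) → PreservesPrefix (suc i′) s
  fixes-prefix _ fix k k<i = k , fix k<i , k<i

  beyond-prefix : {k j : Fin N} → toℕ k < suc i′ → i′ < toℕ j → k ≢ j
  beyond-prefix k<i i′<j refl = ℕP.<⇒≱ i′<j (s≤s⁻¹ k<i)

  ≤n-1 : (k : Fin N) → toℕ k ≤ suc m
  ≤n-1 = FinP.toℕ≤pred[n]

  preserves-minus : (j l : Fin N) (j<l : j Fin.< l) → toℕ l ≤ i′ →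
    PreservesPrefix (suc i′) (reflection (minus j l j<l))
  preserves-minus j l j<l l≤i′ k k<i with toSum (k Fin.≟ j)
  ... | inj₁ refl = l , cong (false ,_) (transpose-matchˡ k l) , s≤s l≤i′
  ... | inj₂ k≢j with toSum (k Fin.≟ l)
  ...   | inj₁ refl = j , cong (false ,_) (transpose-matchʳ j k) , ℕP.<-trans j<l k<i
  ...   | inj₂ k≢l  = k , cong (false ,_) (transpose-fixes k≢j k≢l) , k<i

  classify-minus : (j l : Fin N) (j<l : j Fin.< l) → H (minus j l j<l) → Classified (minus j l j<l)
  classify-minus j l j<l Hr with toℕ l ℕ.≤? i′ | i′ ℕ.<? toℕ j
  ... | yes l≤i′ | _        = inj₁ (preserves-minus j l j<l l≤i′)
  ... | no _     | yes i′<j = inj₁ (fixes-prefix (reflection (minus j l j<l)) λ k<i →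
    cong (false ,_) (transpose-fixes (beyond-prefix k<i i′<j) (beyond-prefix k<i (ℕP.<-trans i′<j j<l))))
  ... | no l≰i′  | no i′≮j with ℕP.<-cmp (suc i′) (toℕ l)
  ...   | tri< i<l _ _ = ⊥-elim (tᵢ∉S i≤n-2 (tₖ-middle∈S (suc i′) (s≤s z≤n) i≤n-2 Hr λ x y x<y x≡ y≡ →
            minus≤minus t x<y j<l (subst (toℕ j ≤_) (sym x≡) (ℕP.≮⇒≥ i′≮j)) (subst (_≤ toℕ l) (sym y≡) i<l)))
    where
    i≤n-2 : suc i′ ≤ m
    i≤n-2 = s≤s⁻¹ (ℕP.<-≤-trans i<l (≤n-1 l))
  ...   | tri> _ _ l<i = ⊥-elim (l≰i′ (s≤s⁻¹ l<i))
  ...   | tri≈ _ i≡l _ with toℕ j ℕ.<? i′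
  ...     | yes j<i′ = ⊥-elim (tᵢ₋₁∉S (tₖ-middle∈S i′ (ℕP.≤-<-trans z≤n j<i′) i′≤m Hr λ x y x<y x≡ y≡ →
              minus≤minus t x<y j<l (subst (toℕ j ≤_) (sym x≡) (ℕP.∸-monoˡ-≤ 1 j<i′))
                                    (ℕP.≤-reflexive (trans y≡ i≡l))))
    where
    i′≤m : i′ ≤ m
    i′≤m = s≤s⁻¹ (subst (_≤ suc m) (sym i≡l) (≤n-1 l))
  ...     | no j≮i′ = inj₂ (inj₁ (l , sym i≡l , cong (_, pos l) (cong pos j≡a)))
    where
    j≡a : j ≡ a
    j≡a = FinP.toℕ-injective (trans (ℕP.≤-antisym (ℕP.≮⇒≥ i′≮j) (ℕP.≮⇒≥ j≮i′)) (sym a≡i′))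

  classify-plus : (j l : Fin N) (j<l : j Fin.< l) → H (plus j l j<l) → Classified (plus j l j<l)
  classify-plus j l j<l Hr with i′ ℕ.<? toℕ j
  ... | yes i′<j = inj₁ (fixes-prefix (reflection (plus j l j<l)) λ k<i →
    let k≢j = beyond-prefix k<i i′<j ; k≢l = beyond-prefix k<i (ℕP.<-trans i′<j j<l) in
    cong₂ _,_ (trBar-sgn-other k≢j k≢l) (transpose-fixes k≢j k≢l))
  ... | no i′≮j with suc i′ ℕ.≤? m
  ...   | yes i≤n-2 = ⊥-elim (tᵢ∉S i≤n-2 (tₖ-middle∈S (suc i′) (s≤s z≤n) i≤n-2 Hr λ x y x<y x≡ _ →
            minus≤plus t x<y j<l (subst (toℕ j ≤_) (sym x≡) (ℕP.≮⇒≥ i′≮j))))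
  ...   | no i≰n-2 = ⊥-elim (tₙ∉S (s≤s⁻¹ (ℕP.≰⇒> i≰n-2)) (tₙ∈S Hr λ x y x<y x≡ y≡ →
            plus≤plus t x<y j<l (subst (toℕ j ≤_) (sym x≡) (s≤s⁻¹ (ℕP.<-≤-trans j<l (≤n-1 l))))
                                (subst (toℕ l ≤_) (sym y≡) (≤n-1 l))))

  classify-short : (j : Fin N) → H (short j) → Classified (short j)
  classify-short j Hr with i′ ℕ.<? toℕ j
  ... | yes i′<j = inj₁ (fixes-prefix (reflection (short j)) λ k<i → cong (_, _) (==F-≢ (beyond-prefix k<i i′<j)))
  ... | no i′≮j with suc i′ ℕ.≤? m
  ...   | yes i≤n-2 = ⊥-elim (tᵢ∉S i≤n-2 (tₖ-middle∈S (suc i′) (s≤s z≤n) i≤n-2 Hr λ x y x<y x≡ _ →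
            minus≤short t x<y (subst (toℕ j ≤_) (sym x≡) (ℕP.≮⇒≥ i′≮j))))
  ...   | no i≰n-2 with toℕ j ℕ.≤? m
  ...     | yes j≤m = ⊥-elim (tₙ₋₁∉S (s≤s⁻¹ (ℕP.≰⇒> i≰n-2)) (tₙ₋₁∈S Hr λ x x≡ →
              short≤short t (subst (toℕ j ≤_) (sym x≡) j≤m)))
  ...     | no j≰m = inj₂ (inj₂ (i′≡n-1 , cong₂ _,_ (cong pos j≡a) (cong neg j≡a)))
    where
    j≡n-1 : toℕ j ≡ suc m
    j≡n-1 = ℕP.≤-antisym (≤n-1 j) (ℕP.≰⇒> j≰m)
    i′≡n-1 : i′ ≡ suc m
    i′≡n-1 = ℕP.≤-antisym i′≤ (subst (_≤ i′) j≡n-1 (ℕP.≮⇒≥ i′≮j))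
    j≡a : j ≡ a
    j≡a = FinP.toℕ-injective (trans j≡n-1 (trans (sym i′≡n-1) (sym a≡i′)))

  classify : (r : Root N) → H r → Classified r
  classify (minus j l j<l) = classify-minus j l j<l
  classify (plus j l j<l)  = classify-plus j l j<l
  classify (short j)       = classify-short j

  adjacent-or-preserves : (b : Fin N) → toℕ b ≡ suc i′ → (r : Root N) → H r →
    PreservesPrefix (suc i′) (reflection r) ⊎ exch r ≡ (pos a , pos b)
  adjacent-or-preserves b b≡i r Hr with classify r Hr
  ... | inj₁ preserves = inj₁ preserves
  ... | inj₂ (inj₁ (b′ , b′≡i , exch≡)) with FinP.toℕ-injective (trans b′≡i (sym b≡i))
  ...   | refl = inj₂ exch≡
  adjacent-or-preserves b b≡i r Hr | inj₂ (inj₂ (refl , _)) = ⊥-elim (ℕP.1+n≰n (subst (_≤ suc m) b≡i (≤n-1 b)))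

  signed-or-preserves : i′ ≡ suc m → (r : Root N) → H r →
    PreservesPrefix (suc i′) (reflection r) ⊎ exch r ≡ (pos a , neg a)
  signed-or-preserves i′≡n-1 r Hr with classify r Hr
  ... | inj₁ preserves           = inj₁ preserves
  ... | inj₂ (inj₁ (b , b≡i , _)) = ⊥-elim (ℕP.1+n≰n (subst (_≤ suc m) (trans b≡i (cong suc i′≡n-1)) (≤n-1 b)))
  ... | inj₂ (inj₂ (_ , exch≡))   = inj₂ exch≡

lemma6p1 : (n : ℕ) → 2 ≤ n → (t : Typ) → (H : Root n → Set) → IsHessenberg t H →
    (i : ℕ) → 1 ≤ i → i ≤ n →
    ((i ≢ n ∸ 1) × ¬ ttInS H (i ∸ 1) × ¬ ttInS H i)
    ⊎ ((i ≡ n ∸ 1) × ¬ ttInS H (n ∸ 2) × ¬ ttInS H (n ∸ 1) × ¬ ttInS H n) →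
    (A : SFin n → Bool) → Unbalanced A → card A ≡ i →
    InM H (f i A)
lemma6p1 (suc (suc m)) (s≤s (s≤s z≤n)) t H (lower , _) (suc i′) (s≤s z≤n) i≤n hyp A _ _ w r Hr =
  by-position (ℕP.m≤n⇒m<n∨m≡n i≤n)
  where
  open Transpositions m using (N; excluded)
  i′≤n-1 : i′ ≤ suc m
  i′≤n-1 = s≤s⁻¹ i≤n
  a : Fin N
  a = fromℕ< (s≤s i′≤n-1)
  a≡i′ : toℕ a ≡ i′
  a≡i′ = FinP.toℕ-fromℕ< (s≤s i′≤n-1)
  a-index : finOf N i′ ≡ just a
  a-index = finOf-just N i′ a a≡i′
  open Classification t H lower i′≤n-1 (excluded H i′ i′≤n-1 hyp) a a≡i′
  by-position : suc i′ < N ⊎ suc i′ ≡ N → (f (suc i′) A w -P f (suc i′) A (w · reflection r)) ∈⟨ ℓ w r ⟩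
  by-position (inj₁ i<n) =
    f-difference-∈⟨ℓ⟩ (suc i′) A _ (λ v → f-below-n (suc i′) A v a-index (finOf-just N (suc i′) b b≡i)) w r
      (xS-difference-reflection-shift w r (pos a) (pos b))
      (map₂ (ℓ-positive-pair w r) (adjacent-or-preserves b b≡i r Hr))
    where
    b : Fin N
    b = fromℕ< i<n
    b≡i : toℕ b ≡ suc i′
    b≡i = FinP.toℕ-fromℕ< i<n
  by-position (inj₂ i≡n) =
    f-difference-∈⟨ℓ⟩ (suc i′) A _ (λ v → f-at-n (suc i′) A v a-index (finOf-nothing N (suc i′) (ℕP.≤-reflexive (sym i≡n))))
      w r
      (xS-reflection-shift w r (pos a))
      (map₂ (ℓ-signed-pair w r) (signed-or-preserves (ℕP.suc-injective i≡n) r Hr))
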